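{- For every odd integer $n\ge 3$, $$\sum_{\substack{0\le k\le n\\ 6\mid k-3}}\binom nk2^kB_{n-k}=\begin{cases}\frac n3\big(1-2^{n-2}-(-3)^{\frac{n-1}2}\big)&\text{if } n\equiv 1\pmod 6,\\ \frac n3\big(1+2^{n-1}-(-3)^{\frac{n-1}2}\big)&\text{if } n\equiv 3,5\pmod 6.\end{cases}$$
   Context: The Bernoulli numbers $B_n$ are defined by $B_0=1$ and $\sum_{k=0}^{n-1}\binom nkB_k=0$ for $n\ge 2$. -}

module Defs where

open import Data.Nat as ℕ using (ℕ; zero; suc; _∸_)
open import Data.Nat.Combinatorics using (_C_)
open import Data.Integer as ℤ using (ℤ; +_)
open import Data.Rational using (ℚ; _/_; _+_; _*_; -_; 0ℚ; 1ℚ)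
open import Data.List using (List; []; _∷_; length; reverse)

ι : ℕ → ℚ
ι n = (+ n) / 1

_^ℚ_ : ℚ → ℕ → ℚ
q ^ℚ zero = 1ℚ
q ^ℚ suc k = q * (q ^ℚ k)

sumTo : ℕ → (ℕ → ℚ) → ℚ
sumTo zero f = f 0
sumTo (suc n) f = sumTo n f + f (suc n)

-- Bernoulli numbers from the recurrence  Σ_{k=0}^{m-1} C(m,k) B_k = 0  (m ≥ 2),
-- solved for B_{m-1}:  B_n = -(1/(n+1)) Σ_{k=0}^{n-1} C(n+1,k) B_k  (n ≥ 1), B_0 = 1.
-- bernList n = [B_n, B_{n-1}, …, B_0]
private
  lookupRev : List ℚ → ℕ → ℚ
  lookupRev xs k = go (reverse xs) k
    where
    go : List ℚ → ℕ → ℚ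
    go [] _ = 0ℚ
    go (x ∷ _) zero = x
    go (_ ∷ ys) (suc i) = go ys i

  partialSum : ℕ → List ℚ → ℕ → ℚ
  partialSum n bs zero = 0ℚ
  partialSum n bs (suc j) = partialSum n bs j + ι ((suc n) C j) * lookupRev bs j

bernList : ℕ → List ℚ
bernList zero = 1ℚ ∷ []
bernList (suc n) =
  let bs = bernList n in
  (- ((+ 1 / suc (suc n)) * partialSum (suc n) bs (suc n))) ∷ bs

B : ℕ → ℚ
B n with bernList n
... | [] = 0ℚ
... | b ∷ _ = b

open import Relation.Nullary using (Dec; yes; no)
open import Data.Integer.Divisibility.Signed using () renaming (_∣?_ to _∣ℤ?_)

lhs : ℕ → ℚ
lhs n = sumTo n term
  where
  term : ℕ → ℚ
  term k with (ℤ.+ 6) ∣ℤ? ((+ k) ℤ.- (+ 3))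
  ... | yes _ = ι (n C k) * (ι 2 ^ℚ k) * B (n ∸ k)
  ... | no _ = 0ℚ

-- Write Bₙ(x) = Σₖ C(n,k) Bₖ xⁿ⁻ᵏ for the Bernoulli polynomials; the recurrence defining
-- the Bₖ gives Bₙ₊₁(1 + y) = Bₙ₊₁(y) + (n + 1) yⁿ.  Let ω be a primitive sixth root of unity.
-- Filtering with the sixth roots of unity turns 6 · Σ_{k ≡ 3 (6)} C(n,k) 2ᵏ B_{n−k} into the
-- alternating sum Σᵢ (−1)ⁱ Bₙ(2ωⁱ).  The six points pair up along unit steps (2 = −2 + 4,
-- 2ω = 2ω² + 2 and 2ω⁵ = 2ω⁴ + 2), so the alternating sum telescopes to n Σ y^(n−1) over the
-- eight points y = −2, −1, 0, 1, 2ω², 2ω² + 1, 2ω⁴, 2ω⁴ + 1.  As n − 1 = 2m is even, these are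
-- powers of y² = 4, 1, 0, 1, 4ω⁴, −3, 4ω², −3, and 4ᵐ(ω⁴ᵐ + ω²ᵐ) is 2 · 4ᵐ or −4ᵐ according as
-- 3 divides m or not.
module Submission where

open import Defs
open import Data.Nat using (ℕ; _≥_; _%_; _∸_) renaming (_/_ to _div_)
open import Data.Nat.Divisibility using (_∣_)
open import Data.Integer using (+_; -[1+_])
open import Data.Rational using (ℚ; _/_; _+_; _-_; _*_)
open import Data.Product using (_×_)
open import Data.Sum using (_⊎_)
open import Relation.Nullary using (¬_)
open import Relation.Binary.PropositionalEquality using (_≡_)

open import Algebra.Bundles using (CommutativeRing)
import Algebra.Properties.CommutativeSemiring.Exp as Exp
import Algebra.Solver.Ring.AlmostCommutativeRing as ACR
import Algebra.Solver.Ring.Simple as RingSolver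
open import Algebra.Structures using (IsCommutativeRing)
open import Data.Bool using (if_then_else_)
open import Data.Fin using (Fin; toℕ)
open import Data.Fin.Patterns using (0F; 1F; 2F; 3F; 4F; 5F)
import Data.Integer as ℤ
open import Data.Integer.Divisibility.Signed using () renaming (_∣_ to _∣ℤ_; _∣?_ to _∣ℤ?_)
import Data.Integer.Divisibility.Signed as ℤ∣
open import Data.Integer.Tactic.RingSolver using (solve-∀)
open import Data.List using (List; []; _∷_; _++_; length; reverse)
open import Data.List.Properties using (unfold-reverse; length-reverse)
open import Data.Nat as ℕ using (zero; suc)
open import Data.Nat.Combinatorics
  using (_C_; k>n⇒nCk≡0; nCk+nC[k+1]≡[n+1]C[k+1]; nCk≡nC[n∸k]; nCn≡1; nC1≡n)
import Data.Nat.Coprimality as Coprime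
open import Data.Nat.Divisibility using (_∣?_; divides; ∣m+n∣m⇒∣n)
open import Data.Nat.DivMod using (m*n/n≡m; m≡m%n+[m/n]*n)
import Data.Nat.Properties as ℕ
open import Data.Nat.Tactic.RingSolver using () renaming (solve-∀ to ℕ-solve-∀)
open import Data.Product using (_,_)
open import Data.Rational using (mkℚ; -_; 0ℚ; 1ℚ; toℚᵘ)
import Data.Rational.Properties as ℚ
open import Data.Rational.Solver using (module +-*-Solver)
import Data.Rational.Unnormalised as ℚᵘ
import Data.Rational.Unnormalised.Properties as ℚᵘ
open import Data.Sum using (inj₁; inj₂; [_,_]′)
open import Function using (_∘_; _⇔_; mk⇔; module Equivalence)
open import Level using (0ℓ)
open import Relation.Binary.Definitions using (DecidableEquality)
open import Relation.Binary.PropositionalEquality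
  using (refl; sym; trans; cong; cong₂; subst; isEquivalence; module ≡-Reasoning)
open import Relation.Nullary using (Dec; does; yes; no)
open import Relation.Nullary.Decidable using (dec-true; dec-false; from-no; map′; _×-dec_)

open +-*-Solver

ι≡mkℚ : ∀ n → ι n ≡ mkℚ (+ n) 0 (Coprime.sym (Coprime.1-coprimeTo n))
ι≡mkℚ n = ℚ.normalize-coprime (Coprime.sym (Coprime.1-coprimeTo n))

ι-suc : ∀ n → ι (suc n) ≡ 1ℚ + ι n
ι-suc n = ℚ.toℚᵘ-injective (ℚᵘ.≃-trans numerators (ℚᵘ.≃-sym (ℚ.toℚᵘ-homo-+ 1ℚ (ι n))))
  where
  numerators : toℚᵘ (ι (suc n)) ℚᵘ.≃ toℚᵘ 1ℚ ℚᵘ.+ toℚᵘ (ι n)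
  numerators rewrite ι≡mkℚ (suc n) | ι≡mkℚ n = ℚᵘ.*≡* (cross-multiplied (+ n))
    where
    cross-multiplied : ∀ x → (+ 1 ℤ.+ x) ℤ.* (+ 1 ℤ.* + 1) ≡ (+ 1 ℤ.* + 1 ℤ.+ x ℤ.* + 1) ℤ.* + 1
    cross-multiplied = solve-∀

ι-+ : ∀ m n → ι (m ℕ.+ n) ≡ ι m + ι n
ι-+ zero n = sym (ℚ.+-identityˡ (ι n))
ι-+ (suc m) n = begin
  ι (suc (m ℕ.+ n))  ≡⟨ ι-suc (m ℕ.+ n) ⟩
  1ℚ + ι (m ℕ.+ n)   ≡⟨ cong (_+_ 1ℚ) (ι-+ m n) ⟩
  1ℚ + (ι m + ι n)   ≡⟨ ℚ.+-assoc 1ℚ (ι m) (ι n) ⟨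
  (1ℚ + ι m) + ι n   ≡⟨ cong (_+ ι n) (ι-suc m) ⟨
  ι (suc m) + ι n    ∎
  where open ≡-Reasoning

ι-*-reciprocal : ∀ n → ι (suc n) * (+ 1 / suc n) ≡ 1ℚ
ι-*-reciprocal n
  rewrite ι≡mkℚ (suc n) | ℚ.normalize-coprime {1} {n} (Coprime.1-coprimeTo (suc n))
  = ℚ.*-inverseʳ (mkℚ (+ suc n) 0 (Coprime.sym (Coprime.1-coprimeTo (suc n))))

sumTo-cong : ∀ n {f g : ℕ → ℚ} → (∀ k → f k ≡ g k) → sumTo n f ≡ sumTo n g
sumTo-cong zero f≗g = f≗g 0
sumTo-cong (suc n) f≗g = cong₂ _+_ (sumTo-cong n f≗g) (f≗g (suc n))

sumTo-cong-≤ : ∀ n {f g : ℕ → ℚ} → (∀ {k} → k ℕ.≤ n → f k ≡ g k) → sumTo n f ≡ sumTo n g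
sumTo-cong-≤ zero f≗g = f≗g ℕ.z≤n
sumTo-cong-≤ (suc n) f≗g = cong₂ _+_ (sumTo-cong-≤ n (f≗g ∘ ℕ.m≤n⇒m≤1+n)) (f≗g ℕ.≤-refl)

sumTo-distrib-+ : ∀ n (f g : ℕ → ℚ) → sumTo n (λ k → f k + g k) ≡ sumTo n f + sumTo n g
sumTo-distrib-+ zero f g = refl
sumTo-distrib-+ (suc n) f g = begin
  sumTo n (λ k → f k + g k) + (f (suc n) + g (suc n))
    ≡⟨ cong (_+ (f (suc n) + g (suc n))) (sumTo-distrib-+ n f g) ⟩
  (sumTo n f + sumTo n g) + (f (suc n) + g (suc n))
    ≡⟨ solve 4 (λ a b c d → (a :+ b) :+ (c :+ d) := (a :+ c) :+ (b :+ d)) refl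
         (sumTo n f) (sumTo n g) (f (suc n)) (g (suc n)) ⟩
  (sumTo n f + f (suc n)) + (sumTo n g + g (suc n)) ∎
  where open ≡-Reasoning

*-distribˡ-sumTo : ∀ n q (f : ℕ → ℚ) → q * sumTo n f ≡ sumTo n (λ k → q * f k)
*-distribˡ-sumTo zero q f = refl
*-distribˡ-sumTo (suc n) q f =
  trans (ℚ.*-distribˡ-+ q (sumTo n f) (f (suc n))) (cong (_+ q * f (suc n)) (*-distribˡ-sumTo n q f))

sumTo-suc : ∀ n (f : ℕ → ℚ) → sumTo (suc n) f ≡ f 0 + sumTo n (f ∘ suc)
sumTo-suc zero f = refl
sumTo-suc (suc n) f = trans (cong (_+ f (suc (suc n))) (sumTo-suc n f)) (ℚ.+-assoc (f 0) _ _)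

binomialSum : ℕ → (ℕ → ℚ) → (ℕ → ℚ) → ℚ
binomialSum n c a = sumTo n (λ k → ι (n C k) * c k * a (n ∸ k))

binomialSum-cong : ∀ n {c d : ℕ → ℚ} a → (∀ k → c k ≡ d k) → binomialSum n c a ≡ binomialSum n d a
binomialSum-cong n a c≗d = sumTo-cong n (λ k → cong (λ x → ι (n C k) * x * a (n ∸ k)) (c≗d k))

binomialSum-*ˡ : ∀ n q (c : ℕ → ℚ) a → binomialSum n (λ k → q * c k) a ≡ q * binomialSum n c a
binomialSum-*ˡ n q c a = trans
  (sumTo-cong n (λ k → solve 4 (λ b q x y → b :* (q :* x) :* y := q :* (b :* x :* y)) refl
                         (ι (n C k)) q (c k) (a (n ∸ k))))
  (sym (*-distribˡ-sumTo n q (λ k → ι (n C k) * c k * a (n ∸ k))))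

-- For j ≥ n the coefficient vanishes, so the truncated subtraction does no harm.
ι-C-suc-∸ : ∀ n j x (f : ℕ → ℚ) →
  ι (n C suc j) * x * f (suc (n ∸ suc j)) ≡ ι (n C suc j) * x * f (n ∸ j)
ι-C-suc-∸ n j x f with j ℕ.<? n
... | yes j<n = cong (λ i → ι (n C suc j) * x * f i) (sym (ℕ.+-∸-assoc 1 j<n))
... | no j≮n rewrite k>n⇒nCk≡0 (ℕ.s≤s (ℕ.≮⇒≥ j≮n)) =
  trans (annihilated (f (suc (n ∸ suc j)))) (sym (annihilated (f (n ∸ j))))
  where
  annihilated : ∀ y → ι 0 * x * y ≡ 0ℚ
  annihilated y = trans (cong (_* y) (ℚ.*-zeroˡ x)) (ℚ.*-zeroˡ y)

binomialSum-suc : ∀ n c a →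
  binomialSum (suc n) c a ≡ binomialSum n c (a ∘ suc) + binomialSum n (c ∘ suc) a
binomialSum-suc n c a = begin
  binomialSum (suc n) c a                  ≡⟨ sumTo-suc n t ⟩
  t 0 + sumTo n (t ∘ suc)                  ≡⟨ cong (_+_ (t 0)) (sumTo-cong n pascal) ⟩
  t 0 + sumTo n (λ j → h (suc j) + g j)    ≡⟨ cong (_+_ (t 0)) (sumTo-distrib-+ n (h ∘ suc) g) ⟩
  h 0 + (sumTo n (h ∘ suc) + sumTo n g)    ≡⟨ ℚ.+-assoc (h 0) _ _ ⟨
  (h 0 + sumTo n (h ∘ suc)) + sumTo n g    ≡⟨ cong (_+ sumTo n g) (sumTo-suc n h) ⟨
  (sumTo n h + h (suc n)) + sumTo n g      ≡⟨ cong (λ x → (sumTo n h + x) + sumTo n g) h[1+n]≡0 ⟩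
  (sumTo n h + 0ℚ) + sumTo n g             ≡⟨ cong (_+ sumTo n g) (ℚ.+-identityʳ (sumTo n h)) ⟩
  binomialSum n c (a ∘ suc) + binomialSum n (c ∘ suc) a ∎
  where
  open ≡-Reasoning
  t h g : ℕ → ℚ
  t k = ι (suc n C k) * c k * a (suc n ∸ k)
  h k = ι (n C k) * c k * a (suc (n ∸ k))
  g k = ι (n C k) * c (suc k) * a (n ∸ k)

  pascal : ∀ j → t (suc j) ≡ h (suc j) + g j
  pascal j = begin
    ι (suc n C suc j) * x * y              ≡⟨ cong (λ b → ι b * x * y) (nCk+nC[k+1]≡[n+1]C[k+1] n j) ⟨
    ι (n C j ℕ.+ n C suc j) * x * y        ≡⟨ cong (λ b → b * x * y) (ι-+ (n C j) (n C suc j)) ⟩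
    (ι (n C j) + ι (n C suc j)) * x * y
      ≡⟨ solve 4 (λ u v x y → (u :+ v) :* x :* y := v :* x :* y :+ u :* x :* y) refl
           (ι (n C j)) (ι (n C suc j)) x y ⟩
    ι (n C suc j) * x * y + g j            ≡⟨ cong (_+ g j) (ι-C-suc-∸ n j x a) ⟨
    h (suc j) + g j                        ∎
    where
    x = c (suc j)
    y = a (n ∸ j)

  h[1+n]≡0 : h (suc n) ≡ 0ℚ
  h[1+n]≡0 rewrite k>n⇒nCk≡0 (ℕ.n<1+n n) =
    trans (cong (_* a (suc (n ∸ suc n))) (ℚ.*-zeroˡ (c (suc n)))) (ℚ.*-zeroˡ (a (suc (n ∸ suc n))))

𝟙 : {P : Set} → Dec P → ℚ
𝟙 P? = if does P? then 1ℚ else 0ℚ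

𝟙-yes : {P : Set} (P? : Dec P) → P → 𝟙 P? ≡ 1ℚ
𝟙-yes P? p = cong (if_then 1ℚ else 0ℚ) (dec-true P? p)

𝟙-no : {P : Set} (P? : Dec P) → ¬ P → 𝟙 P? ≡ 0ℚ
𝟙-no P? ¬p = cong (if_then 1ℚ else 0ℚ) (dec-false P? ¬p)

index : List ℚ → ℕ → ℚ
index [] _ = 0ℚ
index (x ∷ _) zero = x
index (_ ∷ xs) (suc i) = index xs i

index-++ˡ : ∀ xs ys {k} → k ℕ.< length xs → index (xs ++ ys) k ≡ index xs k
index-++ˡ (x ∷ xs) ys {zero} _ = refl
index-++ˡ (x ∷ xs) ys {suc k} (ℕ.s≤s k<n) = index-++ˡ xs ys k<n

index-++-length : ∀ xs y ys → index (xs ++ y ∷ ys) (length xs) ≡ y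
index-++-length [] y ys = refl
index-++-length (x ∷ xs) y ys = index-++-length xs y ys

lookupFromEnd : List ℚ → ℕ → ℚ
lookupFromEnd bs k = index (reverse bs) k

partialSum : ℕ → List ℚ → ℕ → ℚ
partialSum n bs zero = 0ℚ
partialSum n bs (suc j) = partialSum n bs j + ι (suc n C j) * lookupFromEnd bs j

-- The helpers of Defs.bernList are private: the holes below are solved to them by unifying
-- with the unfolding of B (suc N).  Abstracting the operators makes them rigid, which keeps
-- these unification problems in the pattern fragment.
mutual
  go≡index : ∀ xs k ys i → _ ≡ index ys i
  lookupRev≡lookupFromEnd : ∀ bs k → _ ≡ lookupFromEnd bs k
  partialSum≡ : ∀ n bs j → _ ≡ partialSum n bs j

  B-suc-unfolded : ∀ N → B (suc N) ≡ - ((+ 1 / suc (suc N)) *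
    (partialSum (suc N) (bernList N) N + ι (suc (suc N) C N) * lookupFromEnd (bernList N) N))
  B-suc-unfolded N with bernList N | + 1 / suc (suc N) | ι (suc (suc N) C N)
  ... | bs | c | t with suc N | _+_ | _*_ | -_
  ... | m | plus | times | neg = cong (neg ∘ times c)
    (cong₂ plus (partialSum≡ m bs N) (cong (times t) (lookupRev≡lookupFromEnd bs N)))

  partialSum≡ n bs zero = refl
  partialSum≡ n bs (suc j) =
    cong₂ _+_ (partialSum≡ n bs j) (cong (_*_ (ι (suc n C j))) (lookupRev≡lookupFromEnd bs j))

  lookupRev≡lookupFromEnd bs k with reverse bs
  lookupRev≡lookupFromEnd bs k | [] = refl
  lookupRev≡lookupFromEnd bs zero | y ∷ ys = refl
  lookupRev≡lookupFromEnd bs (suc j) | y ∷ ys with suc j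
  ... | m = go≡index bs m ys j

  go≡index xs k [] i = refl
  go≡index xs k (y ∷ ys) zero = refl
  go≡index xs k (y ∷ ys) (suc i) = go≡index xs k ys i

partialSum-suc : ∀ n bs j → partialSum n bs (suc j) ≡ sumTo j (λ k → ι (suc n C k) * lookupFromEnd bs k)
partialSum-suc n bs zero = ℚ.+-identityˡ _
partialSum-suc n bs (suc j) = cong (_+ ι (suc n C suc j) * lookupFromEnd bs (suc j)) (partialSum-suc n bs j)

length-bernList : ∀ N → length (bernList N) ≡ suc N
length-bernList zero = refl
length-bernList (suc N) = cong suc (length-bernList N)

lookupFromEnd-bernList : ∀ N {k} → k ℕ.≤ N → lookupFromEnd (bernList N) k ≡ B k
lookupFromEnd-bernList zero {zero} _ = refl
lookupFromEnd-bernList (suc N) {k} k≤1+N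
  rewrite unfold-reverse (B (suc N)) (bernList N) with ℕ.m≤n⇒m<n∨m≡n k≤1+N
... | inj₁ k<1+N =
  trans (index-++ˡ (reverse (bernList N)) _ k<length) (lookupFromEnd-bernList N (ℕ.<⇒≤pred k<1+N))
  where
  k<length : k ℕ.< length (reverse (bernList N))
  k<length rewrite length-reverse (bernList N) | length-bernList N = k<1+N
... | inj₂ refl = trans
  (cong (index (reverse (bernList N) ++ B (suc N) ∷ []))
    (sym (trans (length-reverse (bernList N)) (length-bernList N))))
  (index-++-length (reverse (bernList N)) (B (suc N)) [])

B-suc : ∀ N → B (suc N) ≡ - ((+ 1 / suc (suc N)) * sumTo N (λ k → ι (suc (suc N) C k) * B k))
B-suc N = trans (B-suc-unfolded N) (cong (λ s → - ((+ 1 / suc (suc N)) * s)) (begin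
  partialSum (suc N) (bernList N) (suc N)                              ≡⟨ partialSum-suc (suc N) (bernList N) N ⟩
  sumTo N (λ k → ι (suc (suc N) C k) * lookupFromEnd (bernList N) k)
    ≡⟨ sumTo-cong-≤ N (λ {k} k≤N → cong (_*_ (ι (suc (suc N) C k))) (lookupFromEnd-bernList N k≤N)) ⟩
  sumTo N (λ k → ι (suc (suc N) C k) * B k)                            ∎))
  where open ≡-Reasoning

B-recurrence : ∀ N → sumTo (suc N) (λ k → ι (suc (suc N) C k) * B k) ≡ 0ℚ
B-recurrence N = begin
  S + ι (suc (suc N) C suc N) * B (suc N)   ≡⟨ cong (λ b → S + ι b * B (suc N)) [N+2]C[N+1]≡N+2 ⟩
  S + ι (suc (suc N)) * B (suc N)           ≡⟨ cong (λ b → S + ι (suc (suc N)) * b) (B-suc N) ⟩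
  S + ι (suc (suc N)) * - (c * S)
    ≡⟨ solve 3 (λ s i c → s :+ i :* (:- (c :* s)) := s :- (i :* c) :* s) refl S (ι (suc (suc N))) c ⟩
  S - (ι (suc (suc N)) * c) * S             ≡⟨ cong (λ x → S - x * S) (ι-*-reciprocal (suc N)) ⟩
  S - 1ℚ * S                                ≡⟨ solve 1 (λ s → s :- con 1ℚ :* s := con 0ℚ) refl S ⟩
  0ℚ                                        ∎
  where
  open ≡-Reasoning
  S = sumTo N (λ k → ι (suc (suc N) C k) * B k)
  c = + 1 / suc (suc N)
  [N+2]C[N+1]≡N+2 : suc (suc N) C suc N ≡ suc (suc N)
  [N+2]C[N+1]≡N+2 = trans (nCk≡nC[n∸k] (ℕ.n≤1+n (suc N)))
    (trans (cong (suc (suc N) C_) (ℕ.m+n∸n≡m 1 (suc N))) (nC1≡n (suc (suc N))))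

binomialSum-B : ∀ n → binomialSum n B (λ _ → 1ℚ) ≡ B n + 𝟙 (n ℕ.≟ 1)
binomialSum-B zero = refl
binomialSum-B (suc zero) = refl
binomialSum-B (suc (suc N)) = begin
  sumTo (suc N) t + ι (suc (suc N) C suc (suc N)) * B (suc (suc N)) * 1ℚ
    ≡⟨ cong₂ (λ s b → s + ι b * B (suc (suc N)) * 1ℚ) (trans (sumTo-cong (suc N) drop-1) (B-recurrence N))
         (nCn≡1 (suc (suc N))) ⟩
  0ℚ + 1ℚ * B (suc (suc N)) * 1ℚ
    ≡⟨ solve 1 (λ b → con 0ℚ :+ con 1ℚ :* b :* con 1ℚ := b :+ con 0ℚ) refl (B (suc (suc N))) ⟩
  B (suc (suc N)) + 0ℚ            ∎
  where
  open ≡-Reasoning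
  t : ℕ → ℚ
  t k = ι (suc (suc N) C k) * B k * 1ℚ
  drop-1 : ∀ k → t k ≡ ι (suc (suc N) C k) * B k
  drop-1 k = ℚ.*-identityʳ _

-- ⟨ a , b ⟩ stands for a + bω, where ω² = ω − 1; thus ω is a primitive sixth root of unity.
record ℚ[ω] : Set where
  constructor ⟨_,_⟩
  field
    c₀ c₁ : ℚ
open ℚ[ω]

infixl 6 _+ω_
infixl 7 _*ω_
infix 8 -ω_

_+ω_ : ℚ[ω] → ℚ[ω] → ℚ[ω]
⟨ a , b ⟩ +ω ⟨ c , d ⟩ = ⟨ a + c , b + d ⟩

_*ω_ : ℚ[ω] → ℚ[ω] → ℚ[ω]
⟨ a , b ⟩ *ω ⟨ c , d ⟩ = ⟨ a * c - b * d , a * d + b * c + b * d ⟩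

-ω_ : ℚ[ω] → ℚ[ω]
-ω ⟨ a , b ⟩ = ⟨ - a , - b ⟩

0ω 1ω ω : ℚ[ω]
0ω = ⟨ 0ℚ , 0ℚ ⟩
1ω = ⟨ 1ℚ , 0ℚ ⟩
ω = ⟨ 0ℚ , 1ℚ ⟩

ℚ[ω]-≡ : ∀ {a b c d} → a ≡ c → b ≡ d → ⟨ a , b ⟩ ≡ ⟨ c , d ⟩
ℚ[ω]-≡ = cong₂ ⟨_,_⟩

_≟ω_ : DecidableEquality ℚ[ω]
⟨ a , b ⟩ ≟ω ⟨ c , d ⟩ = map′ (λ (a≡c , b≡d) → ℚ[ω]-≡ a≡c b≡d) (λ x≡y → cong c₀ x≡y , cong c₁ x≡y)
  (a ℚ.≟ c ×-dec b ℚ.≟ d)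

ℚ[ω]-isCommutativeRing : IsCommutativeRing _≡_ _+ω_ _*ω_ -ω_ 0ω 1ω
ℚ[ω]-isCommutativeRing = record
  { isRing = record
    { +-isAbelianGroup = record
      { isGroup = record
        { isMonoid = record
          { isSemigroup = record
            { isMagma = record { isEquivalence = isEquivalence ; ∙-cong = cong₂ _+ω_ }
            ; assoc = λ x y z → ℚ[ω]-≡ (ℚ.+-assoc (c₀ x) (c₀ y) (c₀ z)) (ℚ.+-assoc (c₁ x) (c₁ y) (c₁ z)) }
          ; identity = (λ x → ℚ[ω]-≡ (ℚ.+-identityˡ (c₀ x)) (ℚ.+-identityˡ (c₁ x)))
                     , (λ x → ℚ[ω]-≡ (ℚ.+-identityʳ (c₀ x)) (ℚ.+-identityʳ (c₁ x))) }
        ; inverse = (λ x → ℚ[ω]-≡ (ℚ.+-inverseˡ (c₀ x)) (ℚ.+-inverseˡ (c₁ x)))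
                  , (λ x → ℚ[ω]-≡ (ℚ.+-inverseʳ (c₀ x)) (ℚ.+-inverseʳ (c₁ x)))
        ; ⁻¹-cong = cong -ω_ }
      ; comm = λ x y → ℚ[ω]-≡ (ℚ.+-comm (c₀ x) (c₀ y)) (ℚ.+-comm (c₁ x) (c₁ y)) }
    ; *-cong = cong₂ _*ω_
    ; *-assoc = *-assoc
    ; *-identity = *-identityˡ , λ x → trans (*-comm x 1ω) (*-identityˡ x)
    ; distrib = (λ x y z → trans (*-comm x (y +ω z))
                                 (trans (distribʳ x y z) (cong₂ _+ω_ (*-comm y x) (*-comm z x))))
              , distribʳ }
  ; *-comm = *-comm }
  where
  *-assoc : ∀ x y z → (x *ω y) *ω z ≡ x *ω (y *ω z)
  *-assoc ⟨ a , b ⟩ ⟨ c , d ⟩ ⟨ e , f ⟩ = ℚ[ω]-≡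
    (solve 6 (λ a b c d e f → (a :* c :- b :* d) :* e :- (a :* d :+ b :* c :+ b :* d) :* f
                              := a :* (c :* e :- d :* f) :- b :* (c :* f :+ d :* e :+ d :* f)) refl a b c d e f)
    (solve 6 (λ a b c d e f → (a :* c :- b :* d) :* f :+ (a :* d :+ b :* c :+ b :* d) :* e
                                :+ (a :* d :+ b :* c :+ b :* d) :* f
                              := a :* (c :* f :+ d :* e :+ d :* f) :+ b :* (c :* e :- d :* f)
                                :+ b :* (c :* f :+ d :* e :+ d :* f)) refl a b c d e f)
  *-comm : ∀ x y → x *ω y ≡ y *ω x
  *-comm ⟨ a , b ⟩ ⟨ c , d ⟩ = ℚ[ω]-≡
    (solve 4 (λ a b c d → a :* c :- b :* d := c :* a :- d :* b) refl a b c d)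
    (solve 4 (λ a b c d → a :* d :+ b :* c :+ b :* d := c :* b :+ d :* a :+ d :* b) refl a b c d)
  *-identityˡ : ∀ x → 1ω *ω x ≡ x
  *-identityˡ ⟨ a , b ⟩ = ℚ[ω]-≡
    (solve 2 (λ a b → con 1ℚ :* a :- con 0ℚ :* b := a) refl a b)
    (solve 2 (λ a b → con 1ℚ :* b :+ con 0ℚ :* a :+ con 0ℚ :* b := b) refl a b)
  distribʳ : ∀ x y z → (y +ω z) *ω x ≡ y *ω x +ω z *ω x
  distribʳ ⟨ a , b ⟩ ⟨ c , d ⟩ ⟨ e , f ⟩ = ℚ[ω]-≡
    (solve 6 (λ a b c d e f → (c :+ e) :* a :- (d :+ f) :* b := (c :* a :- d :* b) :+ (e :* a :- f :* b))
       refl a b c d e f)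
    (solve 6 (λ a b c d e f → (c :+ e) :* b :+ (d :+ f) :* a :+ (d :+ f) :* b
                              := (c :* b :+ d :* a :+ d :* b) :+ (e :* b :+ f :* a :+ f :* b)) refl a b c d e f)

ℚ[ω]-commutativeRing : CommutativeRing 0ℓ 0ℓ
ℚ[ω]-commutativeRing = record { isCommutativeRing = ℚ[ω]-isCommutativeRing }

module ℚ[ω]-Solver = RingSolver (ACR.fromCommutativeRing ℚ[ω]-commutativeRing) _≟ω_
open ℚ[ω]-Solver using ()
  renaming (solve to solveω; _:+_ to _⊕_; _:*_ to _⊗_; :-_ to ⊝_; _:=_ to _⊜_; con to κ)

open CommutativeRing ℚ[ω]-commutativeRing using (*-identityˡ; +-assoc; distribˡ)
open Exp (CommutativeRing.commutativeSemiring ℚ[ω]-commutativeRing) using (^-homo-*; ^-assocʳ; ^-distrib-*)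
  renaming (_^_ to _^ω_)

open import Algebra.Properties.Semiring.Sum (CommutativeRing.semiring ℚ[ω]-commutativeRing)
  using (sum-syntax; ∑-distrib-+; *-distribˡ-sum; *-distribʳ-sum; sum-cong-≗)

infix 9 ↑_
↑_ : ℚ → ℚ[ω]
↑ q = ⟨ q , 0ℚ ⟩

↑-injective : ∀ {p q} → ↑ p ≡ ↑ q → p ≡ q
↑-injective = cong c₀

↑-homo-* : ∀ p q → ↑ (p * q) ≡ ↑ p *ω ↑ q
↑-homo-* p q = ℚ[ω]-≡
  (solve 2 (λ p q → p :* q := p :* q :- con 0ℚ :* con 0ℚ) refl p q)
  (solve 2 (λ p q → con 0ℚ := p :* con 0ℚ :+ con 0ℚ :* q :+ con 0ℚ :* con 0ℚ) refl p q)

↑-homo-^ : ∀ q k → ↑ (q ^ℚ k) ≡ ↑ q ^ω k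
↑-homo-^ q zero = refl
↑-homo-^ q (suc k) = trans (↑-homo-* q (q ^ℚ k)) (cong (↑ q *ω_) (↑-homo-^ q k))

-- appell n a x = Σₖ C(n,k) aₖ xⁿ⁻ᵏ; the recursion is Pascal's rule.
appell : ℕ → (ℕ → ℚ[ω]) → ℚ[ω] → ℚ[ω]
appell zero a x = a 0
appell (suc n) a x = x *ω appell n a x +ω appell n (a ∘ suc) x

appell-cong : ∀ n {a b : ℕ → ℚ[ω]} x → (∀ k → a k ≡ b k) → appell n a x ≡ appell n b x
appell-cong zero x a≗b = a≗b 0
appell-cong (suc n) x a≗b = cong₂ (λ u v → x *ω u +ω v) (appell-cong n x a≗b) (appell-cong n x (a≗b ∘ suc))

appell-+ : ∀ n (a b : ℕ → ℚ[ω]) x → appell n (λ k → a k +ω b k) x ≡ appell n a x +ω appell n b x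
appell-+ zero a b x = refl
appell-+ (suc n) a b x = trans
  (cong₂ (λ u v → x *ω u +ω v) (appell-+ n a b x) (appell-+ n (a ∘ suc) (b ∘ suc) x))
  (solveω 5 (λ x p q r s → x ⊗ (p ⊕ q) ⊕ (r ⊕ s) ⊜ (x ⊗ p ⊕ r) ⊕ (x ⊗ q ⊕ s)) refl
     x (appell n a x) (appell n b x) (appell n (a ∘ suc) x) (appell n (b ∘ suc) x))

appell-*ˡ : ∀ n c (a : ℕ → ℚ[ω]) x → appell n (λ k → c *ω a k) x ≡ c *ω appell n a x
appell-*ˡ zero c a x = refl
appell-*ˡ (suc n) c a x = trans
  (cong₂ (λ u v → x *ω u +ω v) (appell-*ˡ n c a x) (appell-*ˡ n c (a ∘ suc) x))
  (solveω 4 (λ x c p r → x ⊗ (c ⊗ p) ⊕ c ⊗ r ⊜ c ⊗ (x ⊗ p ⊕ r)) refl x c (appell n a x) (appell n (a ∘ suc) x))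

appell-translate : ∀ n (a : ℕ → ℚ[ω]) x y → appell n a (x +ω y) ≡ appell n (λ k → appell k a x) y
appell-translate zero a x y = refl
appell-translate (suc n) a x y = begin
  (x +ω y) *ω appell n a (x +ω y) +ω appell n (a ∘ suc) (x +ω y)
    ≡⟨ cong₂ (λ u v → (x +ω y) *ω u +ω v) (appell-translate n a x y) (appell-translate n (a ∘ suc) x y) ⟩
  (x +ω y) *ω appell n p y +ω appell n q y
    ≡⟨ solveω 4 (λ x y u v → (x ⊕ y) ⊗ u ⊕ v ⊜ y ⊗ u ⊕ (x ⊗ u ⊕ v)) refl x y (appell n p y) (appell n q y) ⟩
  y *ω appell n p y +ω (x *ω appell n p y +ω appell n q y)
    ≡⟨ cong (λ u → y *ω appell n p y +ω (u +ω appell n q y)) (appell-*ˡ n x p y) ⟨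
  y *ω appell n p y +ω (appell n (λ k → x *ω p k) y +ω appell n q y)
    ≡⟨ cong (y *ω appell n p y +ω_) (appell-+ n (λ k → x *ω p k) q y) ⟨
  y *ω appell n p y +ω appell n (λ k → x *ω p k +ω q k) y ∎
  where
  open ≡-Reasoning
  p q : ℕ → ℚ[ω]
  p k = appell k a x
  q k = appell k (a ∘ suc) x

appell-δ₀ : ∀ n x → appell n (λ k → ↑ 𝟙 (k ℕ.≟ 0)) x ≡ x ^ω n
appell-δ₀ zero x = refl
appell-δ₀ (suc n) x = trans
  (cong₂ (λ u v → x *ω u +ω v) (appell-δ₀ n x) (appell-0 n))
  (solveω 2 (λ x p → x ⊗ p ⊕ κ 0ω ⊜ x ⊗ p) refl x (x ^ω n))
  where
  appell-0 : ∀ n → appell n (λ _ → 0ω) x ≡ 0ω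
  appell-0 zero = refl
  appell-0 (suc n) = trans (cong₂ (λ u v → x *ω u +ω v) (appell-0 n) (appell-0 n))
    (solveω 1 (λ x → x ⊗ κ 0ω ⊕ κ 0ω ⊜ κ 0ω) refl x)

appell-δ₁ : ∀ n x → appell (suc n) (λ k → ↑ 𝟙 (k ℕ.≟ 1)) x ≡ ↑ ι (suc n) *ω x ^ω n
appell-δ₁ zero x = solveω 1 (λ x → x ⊗ κ 0ω ⊕ κ 1ω ⊜ κ 1ω ⊗ κ 1ω) refl x
appell-δ₁ (suc n) x = begin
  x *ω appell (suc n) δ₁ x +ω appell (suc n) (δ₁ ∘ suc) x
    ≡⟨ cong₂ (λ u v → x *ω u +ω v) (appell-δ₁ n x) (appell-δ₀ (suc n) x) ⟩
  x *ω (↑ ι (suc n) *ω x ^ω n) +ω x *ω x ^ω n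
    ≡⟨ solveω 3 (λ x m p → x ⊗ (m ⊗ p) ⊕ x ⊗ p ⊜ (κ 1ω ⊕ m) ⊗ (x ⊗ p)) refl x (↑ ι (suc n)) (x ^ω n) ⟩
  (1ω +ω ↑ ι (suc n)) *ω x ^ω suc n
    ≡⟨ cong (λ m → ↑ m *ω x ^ω suc n) (ι-suc (suc n)) ⟨
  ↑ ι (suc (suc n)) *ω x ^ω suc n ∎
  where
  open ≡-Reasoning
  δ₁ : ℕ → ℚ[ω]
  δ₁ k = ↑ 𝟙 (k ℕ.≟ 1)

appell-1 : ∀ n (a : ℕ → ℚ) → appell n (↑_ ∘ a) 1ω ≡ ↑ binomialSum n a (λ _ → 1ℚ)
appell-1 zero a = cong ↑_ (solve 1 (λ x → x := con 1ℚ :* x :* con 1ℚ) refl (a 0))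
appell-1 (suc n) a = begin
  1ω *ω appell n (↑_ ∘ a) 1ω +ω appell n (↑_ ∘ a ∘ suc) 1ω
    ≡⟨ cong₂ _+ω_ (trans (*-identityˡ _) (appell-1 n a)) (appell-1 n (a ∘ suc)) ⟩
  ↑ binomialSum n a (λ _ → 1ℚ) +ω ↑ binomialSum n (a ∘ suc) (λ _ → 1ℚ)
    ≡⟨ cong ↑_ (binomialSum-suc n a (λ _ → 1ℚ)) ⟨
  ↑ binomialSum (suc n) a (λ _ → 1ℚ) ∎
  where open ≡-Reasoning

bernoulli : ℕ → ℚ[ω] → ℚ[ω]
bernoulli n = appell n (↑_ ∘ B)

bernoulli-shift : ∀ n y → bernoulli (suc n) (1ω +ω y) ≡ bernoulli (suc n) y +ω ↑ ι (suc n) *ω y ^ω n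
bernoulli-shift n y = begin
  bernoulli (suc n) (1ω +ω y)                        ≡⟨ appell-translate (suc n) (↑_ ∘ B) 1ω y ⟩
  appell (suc n) (λ k → appell k (↑_ ∘ B) 1ω) y      ≡⟨ appell-cong (suc n) y B[k]+δ₁ ⟩
  appell (suc n) (λ k → ↑ B k +ω ↑ 𝟙 (k ℕ.≟ 1)) y    ≡⟨ appell-+ (suc n) (↑_ ∘ B) _ y ⟩
  bernoulli (suc n) y +ω appell (suc n) (λ k → ↑ 𝟙 (k ℕ.≟ 1)) y
    ≡⟨ cong (bernoulli (suc n) y +ω_) (appell-δ₁ n y) ⟩
  bernoulli (suc n) y +ω ↑ ι (suc n) *ω y ^ω n       ∎
  where
  open ≡-Reasoning
  B[k]+δ₁ : ∀ k → appell k (↑_ ∘ B) 1ω ≡ ↑ B k +ω ↑ 𝟙 (k ℕ.≟ 1)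
  B[k]+δ₁ k = trans (appell-1 k B) (cong ↑_ (binomialSum-B k))

^ω-periodic : ∀ x k r → x ^ω k ≡ 1ω → x ^ω (k ℕ.+ r) ≡ x ^ω r
^ω-periodic x k r xᵏ≡1 = trans (^-homo-* x k r) (trans (cong (_*ω x ^ω r) xᵏ≡1) (*-identityˡ (x ^ω r)))

1^ω : ∀ k → 1ω ^ω k ≡ 1ω
1^ω zero = refl
1^ω (suc k) = trans (*-identityˡ (1ω ^ω k)) (1^ω k)

ζ : Fin 6 → ℚ[ω]
ζ i = ω ^ω toℕ i

ζ⁶≡1 : ∀ i → ζ i ^ω 6 ≡ 1ω
ζ⁶≡1 0F = refl
ζ⁶≡1 1F = refl
ζ⁶≡1 2F = refl
ζ⁶≡1 3F = refl
ζ⁶≡1 4F = refl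
ζ⁶≡1 5F = refl

∑ζ^ : ∀ r → ∑[ i < 6 ] (ζ i ^ω r) ≡ ↑ (ι 6 * 𝟙 (6 ∣? r))
∑ζ^ 0 = refl
∑ζ^ 1 = refl
∑ζ^ 2 = refl
∑ζ^ 3 = refl
∑ζ^ 4 = refl
∑ζ^ 5 = refl
∑ζ^ (suc (suc (suc (suc (suc (suc r)))))) =
  trans (sum-cong-≗ (λ i → ^ω-periodic (ζ i) 6 r (ζ⁶≡1 i))) (∑ζ^ r)

sectionWeight : ℕ → ℕ → ℚ
sectionWeight r k = 𝟙 (6 ∣? k ℕ.+ r) * ι 2 ^ℚ k

sectionWeight-suc : ∀ r k → sectionWeight r (suc k) ≡ ι 2 * sectionWeight (suc r) k
sectionWeight-suc r k = begin
  𝟙 (6 ∣? suc (k ℕ.+ r)) * (ι 2 * ι 2 ^ℚ k)    ≡⟨ cong (λ j → 𝟙 (6 ∣? j) * (ι 2 * ι 2 ^ℚ k)) (ℕ.+-suc k r) ⟨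
  𝟙 (6 ∣? k ℕ.+ suc r) * (ι 2 * ι 2 ^ℚ k)
    ≡⟨ solve 3 (λ d t p → d :* (t :* p) := t :* (d :* p)) refl (𝟙 (6 ∣? k ℕ.+ suc r)) (ι 2) (ι 2 ^ℚ k) ⟩
  ι 2 * sectionWeight (suc r) k                ∎
  where open ≡-Reasoning

2ζ : Fin 6 → ℚ[ω]
2ζ i = ↑ ι 2 *ω ζ i

multisection : ∀ n a r →
  ∑[ i < 6 ] (ζ i ^ω r *ω appell n (↑_ ∘ a) (2ζ i)) ≡ ↑ (ι 6 * binomialSum n (sectionWeight r) a)
multisection zero a r = begin
  ∑[ i < 6 ] (ζ i ^ω r *ω ↑ a 0)          ≡⟨ *-distribʳ-sum (↑ a 0) (λ i → ζ i ^ω r) ⟨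
  (∑[ i < 6 ] (ζ i ^ω r)) *ω ↑ a 0        ≡⟨ cong (_*ω ↑ a 0) (∑ζ^ r) ⟩
  ↑ (ι 6 * 𝟙 (6 ∣? r)) *ω ↑ a 0           ≡⟨ ↑-homo-* (ι 6 * 𝟙 (6 ∣? r)) (a 0) ⟨
  ↑ (ι 6 * 𝟙 (6 ∣? r) * a 0)
    ≡⟨ cong ↑_ (solve 2 (λ d x → con (ι 6) :* d :* x := con (ι 6) :* (con 1ℚ :* (d :* con 1ℚ) :* x)) refl
         (𝟙 (6 ∣? r)) (a 0)) ⟩
  ↑ (ι 6 * binomialSum zero (sectionWeight r) a) ∎
  where open ≡-Reasoning
multisection (suc n) a r = begin
  ∑[ i < 6 ] (ζ i ^ω r *ω (2ζ i *ω A i +ω A′ i))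
    ≡⟨ sum-cong-≗ regroup ⟩
  ∑[ i < 6 ] (↑ ι 2 *ω (ζ i ^ω suc r *ω A i) +ω ζ i ^ω r *ω A′ i)
    ≡⟨ ∑-distrib-+ (λ i → ↑ ι 2 *ω (ζ i ^ω suc r *ω A i)) (λ i → ζ i ^ω r *ω A′ i) ⟩
  ∑[ i < 6 ] (↑ ι 2 *ω (ζ i ^ω suc r *ω A i)) +ω ∑[ i < 6 ] (ζ i ^ω r *ω A′ i)
    ≡⟨ cong (_+ω ∑[ i < 6 ] (ζ i ^ω r *ω A′ i)) (*-distribˡ-sum (↑ ι 2) (λ i → ζ i ^ω suc r *ω A i)) ⟨
  ↑ ι 2 *ω ∑[ i < 6 ] (ζ i ^ω suc r *ω A i) +ω ∑[ i < 6 ] (ζ i ^ω r *ω A′ i)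
    ≡⟨ cong₂ (λ u v → ↑ ι 2 *ω u +ω v) (multisection n a (suc r)) (multisection n (a ∘ suc) r) ⟩
  ↑ ι 2 *ω ↑ (ι 6 * S₁) +ω ↑ (ι 6 * S₀)
    ≡⟨ cong (_+ω ↑ (ι 6 * S₀)) (↑-homo-* (ι 2) (ι 6 * S₁)) ⟨
  ↑ (ι 2 * (ι 6 * S₁) + ι 6 * S₀)
    ≡⟨ cong ↑_ (solve 2 (λ x y → con (ι 2) :* (con (ι 6) :* x) :+ con (ι 6) :* y
                               := con (ι 6) :* (y :+ con (ι 2) :* x)) refl S₁ S₀) ⟩
  ↑ (ι 6 * (S₀ + ι 2 * S₁))
    ≡⟨ cong (λ s → ↑ (ι 6 * (S₀ + s))) (trans (binomialSum-cong n a (sectionWeight-suc r))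
                                                (binomialSum-*ˡ n (ι 2) (sectionWeight (suc r)) a)) ⟨
  ↑ (ι 6 * (S₀ + binomialSum n (sectionWeight r ∘ suc) a))
    ≡⟨ cong (λ s → ↑ (ι 6 * s)) (binomialSum-suc n (sectionWeight r) a) ⟨
  ↑ (ι 6 * binomialSum (suc n) (sectionWeight r) a) ∎
  where
  open ≡-Reasoning
  A A′ : Fin 6 → ℚ[ω]
  A i = appell n (↑_ ∘ a) (2ζ i)
  A′ i = appell n (↑_ ∘ a ∘ suc) (2ζ i)
  S₀ S₁ : ℚ
  S₀ = binomialSum n (sectionWeight r) (a ∘ suc)
  S₁ = binomialSum n (sectionWeight (suc r)) a
  regroup : ∀ i → ζ i ^ω r *ω (2ζ i *ω A i +ω A′ i) ≡ ↑ ι 2 *ω (ζ i ^ω suc r *ω A i) +ω ζ i ^ω r *ω A′ i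
  regroup i = solveω 5 (λ w t x p q → w ⊗ (t ⊗ x ⊗ p ⊕ q) ⊜ t ⊗ (x ⊗ w ⊗ p) ⊕ w ⊗ q) refl
    (ζ i ^ω r) (↑ ι 2) (ζ i) (A i) (A′ i)

6∣ℤ[k-3]⇔6∣[k+3] : ∀ k → + 6 ∣ℤ + k ℤ.- + 3 ⇔ 6 ∣ k ℕ.+ 3
6∣ℤ[k-3]⇔6∣[k+3] k = mk⇔
  (λ 6∣k-3 → ℤ∣.∣⇒∣ᵤ (subst (+ 6 ∣ℤ_) (sym k+3≡6+[k-3]) (ℤ∣.∣m∣n⇒∣m+n ℤ∣.∣-refl 6∣k-3)))
  (λ 6∣k+3 → ℤ∣.∣m+n∣m⇒∣n (subst (+ 6 ∣ℤ_) k+3≡6+[k-3] (ℤ∣.∣ᵤ⇒∣ 6∣k+3)) ℤ∣.∣-refl)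
  where
  k+3≡6+[k-3] : + k ℤ.+ + 3 ≡ + 6 ℤ.+ (+ k ℤ.- + 3)
  k+3≡6+[k-3] = identity (+ k)
    where
    identity : ∀ x → x ℤ.+ + 3 ≡ + 6 ℤ.+ (x ℤ.- + 3)
    identity = solve-∀

-- Defs.lhs sums a where-bound function, so its summand is named by unification, as above.
mutual
  lhs≡binomialSum : ∀ n → lhs n ≡ binomialSum n (sectionWeight 3) B
  lhs≡binomialSum n = trans (sumTo-cong n (lhs-summand n)) (sumTo-cong n regroup)
    where
    regroup : ∀ k → 𝟙 (6 ∣? k ℕ.+ 3) * (ι (n C k) * ι 2 ^ℚ k * B (n ∸ k))
                    ≡ ι (n C k) * sectionWeight 3 k * B (n ∸ k)
    regroup k = solve 4 (λ d c p b → d :* (c :* p :* b) := c :* (d :* p) :* b) refl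
      (𝟙 (6 ∣? k ℕ.+ 3)) (ι (n C k)) (ι 2 ^ℚ k) (B (n ∸ k))

  lhs-summand : ∀ n k → _ ≡ 𝟙 (6 ∣? k ℕ.+ 3) * (ι (n C k) * ι 2 ^ℚ k * B (n ∸ k))
  lhs-summand n k with + 6 ∣ℤ? + k ℤ.- + 3
  ... | yes 6∣k-3 = sym (trans
    (cong (_* (ι (n C k) * ι 2 ^ℚ k * B (n ∸ k))) (𝟙-yes (6 ∣? k ℕ.+ 3) (Equivalence.to (6∣ℤ[k-3]⇔6∣[k+3] k) 6∣k-3)))
    (ℚ.*-identityˡ (ι (n C k) * ι 2 ^ℚ k * B (n ∸ k))))
  ... | no 6∤k-3 = sym (trans
    (cong (_* (ι (n C k) * ι 2 ^ℚ k * B (n ∸ k))) (𝟙-no (6 ∣? k ℕ.+ 3) (6∤k-3 ∘ Equivalence.from (6∣ℤ[k-3]⇔6∣[k+3] k))))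
    (ℚ.*-zeroˡ (ι (n C k) * ι 2 ^ℚ k * B (n ∸ k))))

Δ Δ₂ : ℕ → ℚ[ω] → ℚ[ω]
Δ n y = ↑ ι (suc n) *ω y ^ω n
Δ₂ n y = Δ n y +ω Δ n (1ω +ω y)

bernoulli-shift₂ : ∀ n y → bernoulli (suc n) (1ω +ω (1ω +ω y)) ≡ bernoulli (suc n) y +ω Δ₂ n y
bernoulli-shift₂ n y = begin
  bernoulli (suc n) (1ω +ω (1ω +ω y))                   ≡⟨ bernoulli-shift n (1ω +ω y) ⟩
  bernoulli (suc n) (1ω +ω y) +ω Δ n (1ω +ω y)          ≡⟨ cong (_+ω Δ n (1ω +ω y)) (bernoulli-shift n y) ⟩
  bernoulli (suc n) y +ω Δ n y +ω Δ n (1ω +ω y)         ≡⟨ +-assoc (bernoulli (suc n) y) _ _ ⟩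
  bernoulli (suc n) y +ω Δ₂ n y                         ∎
  where open ≡-Reasoning

alternatingSum-telescopes : ∀ n →
  ∑[ i < 6 ] (ζ i ^ω 3 *ω bernoulli (suc n) (2ζ i))
    ≡ (Δ₂ n (2ζ 3F) +ω Δ₂ n (1ω +ω (1ω +ω 2ζ 3F))) +ω -ω Δ₂ n (2ζ 2F) +ω -ω Δ₂ n (2ζ 4F)
alternatingSum-telescopes n = begin
  ∑[ i < 6 ] (ζ i ^ω 3 *ω b i)
    ≡⟨ solveω 6 (λ g₀ g₁ g₂ g₃ g₄ g₅ →
         κ 1ω ⊗ g₀ ⊕ (κ (-ω 1ω) ⊗ g₁ ⊕ (κ 1ω ⊗ g₂ ⊕ (κ (-ω 1ω) ⊗ g₃ ⊕ (κ 1ω ⊗ g₄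
           ⊕ (κ (-ω 1ω) ⊗ g₅ ⊕ κ 0ω)))))
         ⊜ (g₀ ⊕ ⊝ g₃) ⊕ ⊝ (g₁ ⊕ ⊝ g₂) ⊕ ⊝ (g₅ ⊕ ⊝ g₄)) refl
         (b 0F) (b 1F) (b 2F) (b 3F) (b 4F) (b 5F) ⟩
  (b 0F +ω -ω b 3F) +ω -ω (b 1F +ω -ω b 2F) +ω -ω (b 5F +ω -ω b 4F)
    ≡⟨ cong₂ (λ u v → u +ω -ω v +ω -ω (b 5F +ω -ω b 4F)) b₀-b₃ (difference (bernoulli-shift₂ n (2ζ 2F))) ⟩
  (Δ₂ n (2ζ 3F) +ω Δ₂ n (1ω +ω (1ω +ω 2ζ 3F))) +ω -ω Δ₂ n (2ζ 2F) +ω -ω (b 5F +ω -ω b 4F)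
    ≡⟨ cong (λ v → (Δ₂ n (2ζ 3F) +ω Δ₂ n (1ω +ω (1ω +ω 2ζ 3F))) +ω -ω Δ₂ n (2ζ 2F) +ω -ω v)
         (difference (bernoulli-shift₂ n (2ζ 4F))) ⟩
  (Δ₂ n (2ζ 3F) +ω Δ₂ n (1ω +ω (1ω +ω 2ζ 3F))) +ω -ω Δ₂ n (2ζ 2F) +ω -ω Δ₂ n (2ζ 4F) ∎
  where
  open ≡-Reasoning
  b : Fin 6 → ℚ[ω]
  b i = bernoulli (suc n) (2ζ i)
  difference : ∀ {x y d} → x ≡ y +ω d → x +ω -ω y ≡ d
  difference {y = y} {d} refl = solveω 2 (λ y d → y ⊕ d ⊕ ⊝ y ⊜ d) refl y d
  b₀-b₃ : b 0F +ω -ω b 3F ≡ Δ₂ n (2ζ 3F) +ω Δ₂ n (1ω +ω (1ω +ω 2ζ 3F))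
  b₀-b₃ = difference (trans (bernoulli-shift₂ n (1ω +ω (1ω +ω 2ζ 3F)))
    (trans (cong (_+ω Δ₂ n (1ω +ω (1ω +ω 2ζ 3F))) (bernoulli-shift₂ n (2ζ 3F))) (+-assoc (b 3F) _ _)))

ρ : ℚ[ω]
ρ = ω ^ω 2

∑ρ^ : ∀ k → 1ω +ω ρ ^ω k +ω (ρ ^ω 2) ^ω k ≡ ↑ (ι 3 * 𝟙 (3 ∣? k))
∑ρ^ 0 = refl
∑ρ^ 1 = refl
∑ρ^ 2 = refl
∑ρ^ (suc (suc (suc k))) =
  trans (cong₂ (λ u v → 1ω +ω u +ω v) (^ω-periodic ρ 3 k refl) (^ω-periodic (ρ ^ω 2) 3 k refl)) (∑ρ^ k)

Δ₂-even : ∀ M y → Δ₂ (2 ℕ.* M) y ≡ ↑ ι (suc (2 ℕ.* M)) *ω ((y ^ω 2) ^ω M +ω ((1ω +ω y) ^ω 2) ^ω M)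
Δ₂-even M y = begin
  N *ω y ^ω (2 ℕ.* M) +ω N *ω (1ω +ω y) ^ω (2 ℕ.* M)
    ≡⟨ cong₂ (λ u v → N *ω u +ω N *ω v) (^-assocʳ y 2 M) (^-assocʳ (1ω +ω y) 2 M) ⟨
  N *ω (y ^ω 2) ^ω M +ω N *ω ((1ω +ω y) ^ω 2) ^ω M
    ≡⟨ distribˡ N _ _ ⟨
  N *ω ((y ^ω 2) ^ω M +ω ((1ω +ω y) ^ω 2) ^ω M) ∎
  where
  open ≡-Reasoning
  N = ↑ ι (suc (2 ℕ.* M))

telescopedSum-odd : ∀ m → let M = suc m ; N = ↑ ι (suc (2 ℕ.* M)) ; F = ↑ ι 4 ^ω M ; K = ↑ (-[1+ 2 ] / 1) ^ω M in
  (Δ₂ (2 ℕ.* M) (2ζ 3F) +ω Δ₂ (2 ℕ.* M) (1ω +ω (1ω +ω 2ζ 3F))) +ω -ω Δ₂ (2 ℕ.* M) (2ζ 2F)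
    +ω -ω Δ₂ (2 ℕ.* M) (2ζ 4F)
  ≡ N *ω (↑ ι 2 +ω F *ω (↑ ι 2 +ω -ω (1ω +ω ρ ^ω M +ω (ρ ^ω 2) ^ω M)) +ω -ω (↑ ι 2 *ω K))
telescopedSum-odd m = trans
  (cong₂ (λ u v → u +ω -ω v) (cong₂ (λ u v → u +ω -ω v) (cong₂ _+ω_ Δ₂[−2] Δ₂[0]) Δ₂[2ω²]) Δ₂[2ω⁴])
  (solveω 5 (λ N F K R₁ R₂ →
       (N ⊗ (F ⊕ κ 1ω) ⊕ N ⊗ κ 1ω) ⊕ ⊝ (N ⊗ (F ⊗ R₂ ⊕ K)) ⊕ ⊝ (N ⊗ (F ⊗ R₁ ⊕ K))
     ⊜ N ⊗ (κ (↑ ι 2) ⊕ F ⊗ (κ (↑ ι 2) ⊕ ⊝ (κ 1ω ⊕ R₁ ⊕ R₂)) ⊕ ⊝ (κ (↑ ι 2) ⊗ K))) refl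
     N F K (ρ ^ω M) ((ρ ^ω 2) ^ω M))
  where
  M = suc m
  N F K : ℚ[ω]
  N = ↑ ι (suc (2 ℕ.* M))
  F = ↑ ι 4 ^ω M
  K = ↑ (-[1+ 2 ] / 1) ^ω M
  Δ₂[−2] : Δ₂ (2 ℕ.* M) (2ζ 3F) ≡ N *ω (F +ω 1ω)
  Δ₂[−2] = trans (Δ₂-even M (2ζ 3F)) (cong (λ u → N *ω (F +ω u)) (1^ω M))
  Δ₂[0] : Δ₂ (2 ℕ.* M) (1ω +ω (1ω +ω 2ζ 3F)) ≡ N *ω 1ω
  Δ₂[0] = trans (Δ₂-even M (1ω +ω (1ω +ω 2ζ 3F))) (cong₂ (λ u v → N *ω (u +ω v))
    (solveω 1 (λ z → κ 0ω ⊗ z ⊜ κ 0ω) refl (0ω ^ω m)) (1^ω M))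
  Δ₂[2ω²] : Δ₂ (2 ℕ.* M) (2ζ 2F) ≡ N *ω (F *ω (ρ ^ω 2) ^ω M +ω K)
  Δ₂[2ω²] = trans (Δ₂-even M (2ζ 2F)) (cong (λ u → N *ω (u +ω K)) (^-distrib-* (↑ ι 4) (ρ ^ω 2) M))
  Δ₂[2ω⁴] : Δ₂ (2 ℕ.* M) (2ζ 4F) ≡ N *ω (F *ω ρ ^ω M +ω K)
  Δ₂[2ω⁴] = trans (Δ₂-even M (2ζ 4F)) (cong (λ u → N *ω (u +ω K)) (^-distrib-* (↑ ι 4) ρ M))

ι6*lhs-odd : ∀ m → let k = suc m ; n = suc (2 ℕ.* k) in
  ι 6 * lhs n ≡ ι n * (ι 2 + ι 4 ^ℚ k * (ι 2 - ι 3 * 𝟙 (3 ∣? k)) - ι 2 * (-[1+ 2 ] / 1) ^ℚ k)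
ι6*lhs-odd m = ↑-injective (begin
  ↑ (ι 6 * lhs n)                               ≡⟨ cong (λ x → ↑ (ι 6 * x)) (lhs≡binomialSum n) ⟩
  ↑ (ι 6 * binomialSum n (sectionWeight 3) B)   ≡⟨ multisection n B 3 ⟨
  ∑[ i < 6 ] (ζ i ^ω 3 *ω bernoulli n (2ζ i))   ≡⟨ alternatingSum-telescopes (2 ℕ.* k) ⟩
  _                                             ≡⟨ telescopedSum-odd m ⟩
  ↑ ι n *ω (↑ ι 2 +ω ↑ ι 4 ^ω k *ω (↑ ι 2 +ω -ω (1ω +ω ρ ^ω k +ω (ρ ^ω 2) ^ω k))
            +ω -ω (↑ ι 2 *ω ↑ c ^ω k))
    ≡⟨ cong₂ (λ u v → ↑ ι n *ω (↑ ι 2 +ω ↑ ι 4 ^ω k *ω (↑ ι 2 +ω -ω u) +ω -ω (↑ ι 2 *ω v)))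
         (∑ρ^ k) (sym (↑-homo-^ c k)) ⟩
  ↑ ι n *ω (↑ ι 2 +ω ↑ ι 4 ^ω k *ω ↑ (ι 2 - ι 3 * δ) +ω -ω (↑ ι 2 *ω ↑ (c ^ℚ k)))
    ≡⟨ cong (λ u → ↑ ι n *ω (↑ ι 2 +ω u *ω ↑ (ι 2 - ι 3 * δ) +ω -ω (↑ ι 2 *ω ↑ (c ^ℚ k))))
         (↑-homo-^ (ι 4) k) ⟨
  ↑ ι n *ω (↑ ι 2 +ω ↑ (ι 4 ^ℚ k) *ω ↑ (ι 2 - ι 3 * δ) +ω -ω (↑ ι 2 *ω ↑ (c ^ℚ k)))
    ≡⟨ ↑-homo (ι n) (ι 4 ^ℚ k) (ι 2 - ι 3 * δ) (c ^ℚ k) ⟨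
  ↑ (ι n * (ι 2 + ι 4 ^ℚ k * (ι 2 - ι 3 * δ) - ι 2 * c ^ℚ k)) ∎)
  where
  open ≡-Reasoning
  k = suc m
  n = suc (2 ℕ.* k)
  c = -[1+ 2 ] / 1
  δ = 𝟙 (3 ∣? k)
  ↑-homo : ∀ a p d q → ↑ (a * (ι 2 + p * d - ι 2 * q)) ≡ ↑ a *ω (↑ ι 2 +ω ↑ p *ω ↑ d +ω -ω (↑ ι 2 *ω ↑ q))
  ↑-homo a p d q = trans (↑-homo-* a _)
    (cong (↑ a *ω_) (cong₂ (λ u v → ↑ ι 2 +ω u +ω -ω v) (↑-homo-* p d) (↑-homo-* (ι 2) q)))

ι2^[2*k]≡ι4^k : ∀ k → ι 2 ^ℚ (2 ℕ.* k) ≡ ι 4 ^ℚ k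
ι2^[2*k]≡ι4^k k = ↑-injective (begin
  ↑ (ι 2 ^ℚ (2 ℕ.* k))   ≡⟨ ↑-homo-^ (ι 2) (2 ℕ.* k) ⟩
  ↑ ι 2 ^ω (2 ℕ.* k)     ≡⟨ ^-assocʳ (↑ ι 2) 2 k ⟨
  ↑ ι 4 ^ω k             ≡⟨ ↑-homo-^ (ι 4) k ⟨
  ↑ (ι 4 ^ℚ k)           ∎)
  where open ≡-Reasoning

[2*k]/2≡k : ∀ k → (2 ℕ.* k) div 2 ≡ k
[2*k]/2≡k k = trans (cong (_div 2) (ℕ.*-comm 2 k)) (m*n/n≡m k 2)

x≡6⁻¹*[6*x] : ∀ x → x ≡ (+ 1 / 6) * (ι 6 * x)
x≡6⁻¹*[6*x] = solve 1 (λ x → x := con (+ 1 / 6) :* (con (ι 6) :* x)) refl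

closedForm₁ closedForm₃₅ : ℕ → ℚ
closedForm₁ n = (ι n * (+ 1 / 3)) * ((ι 1 - ι 2 ^ℚ (n ∸ 2)) - (-[1+ 2 ] / 1) ^ℚ ((n ∸ 1) div 2))
closedForm₃₅ n = (ι n * (+ 1 / 3)) * ((ι 1 + ι 2 ^ℚ (n ∸ 1)) - (-[1+ 2 ] / 1) ^ℚ ((n ∸ 1) div 2))

lhs-odd-3∣ : ∀ k → 1 ℕ.≤ k → 3 ∣ k → lhs (suc (2 ℕ.* k)) ≡ closedForm₁ (suc (2 ℕ.* k))
lhs-odd-3∣ (suc m) _ 3∣k = begin
  lhs n                                                          ≡⟨ x≡6⁻¹*[6*x] (lhs n) ⟩
  (+ 1 / 6) * (ι 6 * lhs n)                                      ≡⟨ cong (_*_ (+ 1 / 6)) (ι6*lhs-odd m) ⟩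
  (+ 1 / 6) * (ι n * (ι 2 + ι 4 ^ℚ k * (ι 2 - ι 3 * 𝟙 (3 ∣? k)) - ι 2 * c ^ℚ k))
    ≡⟨ cong₂ (λ p d → (+ 1 / 6) * (ι n * (ι 2 + p * (ι 2 - ι 3 * d) - ι 2 * c ^ℚ k)))
         (sym (ι2^[2*k]≡ι4^k k)) (𝟙-yes (3 ∣? k) 3∣k) ⟩
  (+ 1 / 6) * (ι n * (ι 2 + ι 2 * Q * (ι 2 - ι 3 * 1ℚ) - ι 2 * c ^ℚ k))
    ≡⟨ solve 3 (λ n q c → con (+ 1 / 6) :* (n :* (con (ι 2) :+ con (ι 2) :* q :* (con (ι 2) :- con (ι 3) :* con 1ℚ)
                                               :- con (ι 2) :* c))
                          := (n :* con (+ 1 / 3)) :* ((con (ι 1) :- q) :- c)) refl (ι n) Q (c ^ℚ k) ⟩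
  (ι n * (+ 1 / 3)) * ((ι 1 - Q) - c ^ℚ k)
    ≡⟨ cong (λ j → (ι n * (+ 1 / 3)) * ((ι 1 - Q) - c ^ℚ j)) ([2*k]/2≡k k) ⟨
  closedForm₁ n ∎
  where
  open ≡-Reasoning
  k = suc m
  n = suc (2 ℕ.* k)
  c = -[1+ 2 ] / 1
  -- ι 2 * Q computes to ι 2 ^ℚ (2 ℕ.* k), as k is a successor.
  Q = ι 2 ^ℚ (n ∸ 2)

lhs-odd-3∤ : ∀ k → 1 ℕ.≤ k → ¬ 3 ∣ k → lhs (suc (2 ℕ.* k)) ≡ closedForm₃₅ (suc (2 ℕ.* k))
lhs-odd-3∤ (suc m) _ 3∤k = begin
  lhs n                                                          ≡⟨ x≡6⁻¹*[6*x] (lhs n) ⟩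
  (+ 1 / 6) * (ι 6 * lhs n)                                      ≡⟨ cong (_*_ (+ 1 / 6)) (ι6*lhs-odd m) ⟩
  (+ 1 / 6) * (ι n * (ι 2 + ι 4 ^ℚ k * (ι 2 - ι 3 * 𝟙 (3 ∣? k)) - ι 2 * c ^ℚ k))
    ≡⟨ cong₂ (λ p d → (+ 1 / 6) * (ι n * (ι 2 + p * (ι 2 - ι 3 * d) - ι 2 * c ^ℚ k)))
         (sym (ι2^[2*k]≡ι4^k k)) (𝟙-no (3 ∣? k) 3∤k) ⟩
  (+ 1 / 6) * (ι n * (ι 2 + P * (ι 2 - ι 3 * 0ℚ) - ι 2 * c ^ℚ k))
    ≡⟨ solve 3 (λ n p c → con (+ 1 / 6) :* (n :* (con (ι 2) :+ p :* (con (ι 2) :- con (ι 3) :* con 0ℚ)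
                                               :- con (ι 2) :* c))
                          := (n :* con (+ 1 / 3)) :* ((con (ι 1) :+ p) :- c)) refl (ι n) P (c ^ℚ k) ⟩
  (ι n * (+ 1 / 3)) * ((ι 1 + P) - c ^ℚ k)
    ≡⟨ cong (λ j → (ι n * (+ 1 / 3)) * ((ι 1 + P) - c ^ℚ j)) ([2*k]/2≡k k) ⟨
  closedForm₃₅ n ∎
  where
  open ≡-Reasoning
  k = suc m
  n = suc (2 ℕ.* k)
  c = -[1+ 2 ] / 1
  P = ι 2 ^ℚ (n ∸ 1)

odd-from-residue : ∀ n t → n % 6 ≡ suc (2 ℕ.* t) → n ≡ suc (2 ℕ.* (t ℕ.+ n div 6 ℕ.* 3))
odd-from-residue n t n%6≡1+2t = begin
  n                                     ≡⟨ m≡m%n+[m/n]*n n 6 ⟩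
  n % 6 ℕ.+ n div 6 ℕ.* 6               ≡⟨ cong (ℕ._+ n div 6 ℕ.* 6) n%6≡1+2t ⟩
  suc (2 ℕ.* t) ℕ.+ n div 6 ℕ.* 6       ≡⟨ regroup t (n div 6) ⟩
  suc (2 ℕ.* (t ℕ.+ n div 6 ℕ.* 3))     ∎
  where
  open ≡-Reasoning
  regroup : ∀ t q → suc (2 ℕ.* t) ℕ.+ q ℕ.* 6 ≡ suc (2 ℕ.* (t ℕ.+ q ℕ.* 3))
  regroup = ℕ-solve-∀

3≤1+2k⇒1≤k : ∀ k → 3 ℕ.≤ suc (2 ℕ.* k) → 1 ℕ.≤ k
3≤1+2k⇒1≤k zero (ℕ.s≤s ())
3≤1+2k⇒1≤k (suc k) _ = ℕ.s≤s ℕ.z≤n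

lhs-residue₁ : ∀ n → n ≥ 3 → n % 6 ≡ 1 → lhs n ≡ closedForm₁ n
lhs-residue₁ n n≥3 n%6≡1 = subst (λ j → lhs j ≡ closedForm₁ j) (sym n≡1+2k)
  (lhs-odd-3∣ k (3≤1+2k⇒1≤k k (subst (3 ℕ.≤_) n≡1+2k n≥3)) (divides (n div 6) refl))
  where
  k = n div 6 ℕ.* 3
  n≡1+2k = odd-from-residue n 0 n%6≡1

lhs-residue₃₅ : ∀ n t → ¬ 3 ∣ t → n ≥ 3 → n % 6 ≡ suc (2 ℕ.* t) → lhs n ≡ closedForm₃₅ n
lhs-residue₃₅ n t 3∤t n≥3 n%6≡1+2t = subst (λ j → lhs j ≡ closedForm₃₅ j) (sym n≡1+2k)
  (lhs-odd-3∤ k (3≤1+2k⇒1≤k k (subst (3 ℕ.≤_) n≡1+2k n≥3)) (3∤t ∘ 3∣t+3q⇒3∣t))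
  where
  k = t ℕ.+ n div 6 ℕ.* 3
  n≡1+2k = odd-from-residue n t n%6≡1+2t
  3∣t+3q⇒3∣t : 3 ∣ k → 3 ∣ t
  3∣t+3q⇒3∣t 3∣k = ∣m+n∣m⇒∣n (subst (3 ∣_) (ℕ.+-comm t (n div 6 ℕ.* 3)) 3∣k) (divides (n div 6) refl)

-- The hypothesis that n is odd is implied by its residue modulo 6.
corollary2p1 : (n : ℕ) → n ≥ 3 → ¬ (2 ∣ n) →
    (n % 6 ≡ 1 →
      lhs n ≡ (ι n * (+ 1 / 3)) * ((ι 1 - (ι 2 ^ℚ (n ∸ 2))) - (-[1+ 2 ] / 1) ^ℚ ((n ∸ 1) div 2)))
    × ((n % 6 ≡ 3 ⊎ n % 6 ≡ 5) →
      lhs n ≡ (ι n * (+ 1 / 3)) * ((ι 1 + (ι 2 ^ℚ (n ∸ 1))) - (-[1+ 2 ] / 1) ^ℚ ((n ∸ 1) div 2)))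
corollary2p1 n n≥3 _ =
  lhs-residue₁ n n≥3 ,
  [ lhs-residue₃₅ n 1 (from-no (3 ∣? 1)) n≥3 , lhs-residue₃₅ n 2 (from-no (3 ∣? 2)) n≥3 ]′
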